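{- Let $H$ be an iteratable endofunctor of a category $\mathcal A$ with finite coproducts, and let $\mathbb T$ be the free completely iterative monad of $H$. Then the category $\mathrm{CElgot}\,H$ of complete Elgot algebras and solution-preserving morphisms is isomorphic to the Eilenberg--Moore category $\mathcal A^{\mathbb T}$ of $\mathbb T$-algebras.
   Context: $H$ is iteratable if for every object $Y$ the functor $H(-)+Y$ has a final coalgebra $TY$; equivalently, free completely iterative $H$-algebras $TY$ exist on every object $Y$, and $\mathbb T$ is the monad arising from the free completely iterative algebra adjunction (it is the free completely iterative monad on $H$). Coproduct injections are $\mathrm{inl},\mathrm{inr}$. For an $H$-algebra $\alpha:HA\to A$, a flat equation morphism in $A$ is any morphism $e:X\to HX+A$; a solution is $e^\dagger:X\to A$ with $e^\dagger=[\alpha,\mathrm{id}_A]\cdot(He^\dagger+\mathrm{id}_A)\cdot e$; a completely iterative algebra is one where every flat equation morphism has a unique solution. For $e:X\to HX+Y$ and $h:Y\to Z$, $h\bullet e:=(\mathrm{id}_{HX}+h)\cdot e$; for $e:X\to HX+Y$, $f:Y\to HY+A$, $f\oplus e:=(\mathrm{can}+\mathrm{id}_A)\cdot(\mathrm{id}_{HX}+f)\cdot[e,\mathrm{inr}]$ with $\mathrm{can}=[H\mathrm{inl},H\mathrm{inr}]$. A complete Elgot algebra is an $H$-algebra with an assignment $e\mapsto e^\dagger$ of a solution to every flat equation morphism that is functorial ($e^\dagger=f^\dagger\cdot h$ whenever $e:X\to HX+A$, $f:Y\to HY+A$, $h:X\to Y$ with $(Hh+\mathrm{id}_A)\cdot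 e=f\cdot h$) and compositional ($(f^\dagger\bullet e)^\dagger=(f\oplus e)^\dagger\cdot\mathrm{inl}$ for all $e:X\to HX+Y$, $f:Y\to HY+A$). A morphism $h:A\to B$ of complete Elgot algebras $(A,\alpha,(-)^\dagger)$, $(B,\beta,(-)^\ddagger)$ is solution-preserving if $h\cdot e^\dagger=(h\bullet e)^\ddagger$ for every flat equation morphism $e$ in $A$. -}

module Defs where

open import Level using (Level; _⊔_) renaming (suc to lsuc)
open import Relation.Binary using (Rel; IsEquivalence; Setoid)
open import Relation.Binary.PropositionalEquality using (_≡_) renaming (refl to ≡-refl)

record Category (o ℓ e : Level) : Set (lsuc (o ⊔ ℓ ⊔ e)) where
  infix  4 _≈_ _⇒_
  infixr 9 _∘_
  field
    Obj       : Set o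
    _⇒_       : Obj → Obj → Set ℓ
    _≈_       : ∀ {A B} → Rel (A ⇒ B) e
    id        : ∀ {A} → A ⇒ A
    _∘_       : ∀ {A B C} → B ⇒ C → A ⇒ B → A ⇒ C
    assoc     : ∀ {A B C D} {f : A ⇒ B} {g : B ⇒ C} {h : C ⇒ D} →
                (h ∘ g) ∘ f ≈ h ∘ (g ∘ f)
    identityˡ : ∀ {A B} {f : A ⇒ B} → id ∘ f ≈ f
    identityʳ : ∀ {A B} {f : A ⇒ B} → f ∘ id ≈ f
    equiv     : ∀ {A B} → IsEquivalence (_≈_ {A} {B})
    ∘-resp-≈  : ∀ {A B C} {f h : B ⇒ C} {g i : A ⇒ B} →
                f ≈ h → g ≈ i → f ∘ g ≈ h ∘ i

  hom-setoid : Obj → Obj → Setoid ℓ e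
  hom-setoid A B = record { Carrier = A ⇒ B ; _≈_ = _≈_ ; isEquivalence = equiv }

  module Equiv {A B : Obj} = IsEquivalence (equiv {A} {B})

record Functor {o ℓ e o′ ℓ′ e′ : Level} (C : Category o ℓ e) (D : Category o′ ℓ′ e′)
       : Set (o ⊔ ℓ ⊔ e ⊔ o′ ⊔ ℓ′ ⊔ e′) where
  private
    module C = Category C
    module D = Category D
  field
    F₀           : C.Obj → D.Obj
    F₁           : ∀ {A B} → A C.⇒ B → F₀ A D.⇒ F₀ B
    identity     : ∀ {A} → F₁ (C.id {A}) D.≈ D.id
    homomorphism : ∀ {X Y Z} {f : X C.⇒ Y} {g : Y C.⇒ Z} →
                   F₁ (g C.∘ f) D.≈ F₁ g D.∘ F₁ f
    F-resp-≈     : ∀ {A B} {f g : A C.⇒ B} → f C.≈ g → F₁ f D.≈ F₁ g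

record FiniteCoproducts {o ℓ e : Level} (𝒜 : Category o ℓ e) : Set (o ⊔ ℓ ⊔ e) where
  open Category 𝒜
  infixr 6 _+_
  field
    ⊥        : Obj
    ¡        : ∀ {A} → ⊥ ⇒ A
    ¡-unique : ∀ {A} (f : ⊥ ⇒ A) → ¡ ≈ f
    _+_      : Obj → Obj → Obj
    inl      : ∀ {A B} → A ⇒ A + B
    inr      : ∀ {A B} → B ⇒ A + B
    [_,_]    : ∀ {A B C} → A ⇒ C → B ⇒ C → A + B ⇒ C
    inject₁  : ∀ {A B C} {f : A ⇒ C} {g : B ⇒ C} → [ f , g ] ∘ inl ≈ f
    inject₂  : ∀ {A B C} {f : A ⇒ C} {g : B ⇒ C} → [ f , g ] ∘ inr ≈ g
    unique   : ∀ {A B C} {f : A ⇒ C} {g : B ⇒ C} {h : A + B ⇒ C} →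
               h ∘ inl ≈ f → h ∘ inr ≈ g → [ f , g ] ≈ h

module Theory {o ℓ e : Level} (𝒜 : Category o ℓ e) (cop : FiniteCoproducts 𝒜)
              (H : Functor 𝒜 𝒜) where

  open Category 𝒜
  open FiniteCoproducts cop
  open Functor H renaming (F₀ to H₀; F₁ to H₁)
  open Equiv

  infixr 7 _⊹_
  _⊹_ : ∀ {A B C D} → A ⇒ B → C ⇒ D → A + C ⇒ B + D
  f ⊹ g = [ inl ∘ f , inr ∘ g ]

  -- reassociation  P + (Q + R) → (P + Q) + R  (left implicit in the paper)
  assocʳ : ∀ {P Q R} → P + (Q + R) ⇒ (P + Q) + R
  assocʳ = [ inl ∘ inl , [ inl ∘ inr , inr ] ]

  can : ∀ {X Y} → H₀ X + H₀ Y ⇒ H₀ (X + Y)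
  can = [ H₁ inl , H₁ inr ]

  record FinalCoalgebra (Y : Obj) : Set (o ⊔ ℓ ⊔ e) where
    field
      ν        : Obj
      τ        : ν ⇒ H₀ ν + Y
      unfold   : ∀ {X} → X ⇒ H₀ X + Y → X ⇒ ν
      unfold-hom    : ∀ {X} (c : X ⇒ H₀ X + Y) →
                      τ ∘ unfold c ≈ (H₁ (unfold c) ⊹ id) ∘ c
      unfold-unique : ∀ {X} (c : X ⇒ H₀ X + Y) (h : X ⇒ ν) →
                      τ ∘ h ≈ (H₁ h ⊹ id) ∘ c → h ≈ unfold c

  Iteratable : Set (o ⊔ ℓ ⊔ e)
  Iteratable = ∀ Y → FinalCoalgebra Y

  IsSolution : ∀ {A X} (α : H₀ A ⇒ A) (eq : X ⇒ H₀ X + A) (s : X ⇒ A) → Set e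
  IsSolution α eq s = s ≈ [ α , id ] ∘ (H₁ s ⊹ id) ∘ eq

  _•_ : ∀ {X Y Z} → Y ⇒ Z → X ⇒ H₀ X + Y → X ⇒ H₀ X + Z
  h • e = (id ⊹ h) ∘ e

  _⊕_ : ∀ {X Y A} → Y ⇒ H₀ Y + A → X ⇒ H₀ X + Y → X + Y ⇒ H₀ (X + Y) + A
  f ⊕ e = (can ⊹ id) ∘ assocʳ ∘ (id ⊹ f) ∘ [ e , inr ]

  record IsCIA (A : Obj) (α : H₀ A ⇒ A) : Set (o ⊔ ℓ ⊔ e) where
    field
      sol        : ∀ {X} → X ⇒ H₀ X + A → X ⇒ A
      sol-isSol  : ∀ {X} (e : X ⇒ H₀ X + A) → IsSolution α e (sol e)
      sol-unique : ∀ {X} (e : X ⇒ H₀ X + A) (s : X ⇒ A) →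
                   IsSolution α e s → s ≈ sol e

  IsAlgHom : ∀ {A B} → H₀ A ⇒ A → H₀ B ⇒ B → A ⇒ B → Set e
  IsAlgHom α β h = h ∘ α ≈ β ∘ H₁ h

  record FreeCIA (Y : Obj) : Set (o ⊔ ℓ ⊔ e) where
    field
      T      : Obj
      α      : H₀ T ⇒ T
      cia    : IsCIA T α
      η      : Y ⇒ T
      ext    : ∀ {B} {β : H₀ B ⇒ B} → IsCIA B β → Y ⇒ B → T ⇒ B
      ext-hom    : ∀ {B} {β : H₀ B ⇒ B} (c : IsCIA B β) (f : Y ⇒ B) →
                   IsAlgHom α β (ext c f)
      ext-η      : ∀ {B} {β : H₀ B ⇒ B} (c : IsCIA B β) (f : Y ⇒ B) →
                   ext c f ∘ η ≈ f
      ext-unique : ∀ {B} {β : H₀ B ⇒ B} (c : IsCIA B β) (f : Y ⇒ B) (h : T ⇒ B) →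
                   IsAlgHom α β h → h ∘ η ≈ f → h ≈ ext c f

  FreeCIAs : Set (o ⊔ ℓ ⊔ e)
  FreeCIAs = ∀ Y → FreeCIA Y

  record ElgotAlgebra : Set (o ⊔ ℓ ⊔ e) where
    field
      A     : Obj
      α     : H₀ A ⇒ A
      _†    : ∀ {X} → X ⇒ H₀ X + A → X ⇒ A
      †-solution    : ∀ {X} (e : X ⇒ H₀ X + A) → IsSolution α e (e †)
      †-functorial  : ∀ {X Y} (e : X ⇒ H₀ X + A) (f : Y ⇒ H₀ Y + A) (h : X ⇒ Y) →
                      (H₁ h ⊹ id) ∘ e ≈ f ∘ h → e † ≈ (f †) ∘ h
      †-compositional : ∀ {X Y} (e : X ⇒ H₀ X + Y) (f : Y ⇒ H₀ Y + A) →
                      ((f †) • e) † ≈ ((f ⊕ e) †) ∘ inl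

  record ElgotHom (𝔸 𝔹 : ElgotAlgebra) : Set (o ⊔ ℓ ⊔ e) where
    private
      module 𝔸 = ElgotAlgebra 𝔸
      module 𝔹 = ElgotAlgebra 𝔹
    field
      mor          : 𝔸.A ⇒ 𝔹.A
      preserves-†  : ∀ {X} (e : X ⇒ H₀ X + 𝔸.A) → mor ∘ (e 𝔸.†) ≈ (mor • e) 𝔹.†


  []-cong : ∀ {A B C} {f f′ : A ⇒ C} {g g′ : B ⇒ C} → f ≈ f′ → g ≈ g′ → [ f , g ] ≈ [ f′ , g′ ]
  []-cong {f = f} {f′} {g} {g′} p q =
    sym (unique (trans inject₁ p) (trans inject₂ q))

  ∘-[] : ∀ {A B C D} {f : A ⇒ C} {g : B ⇒ C} {h : C ⇒ D} → h ∘ [ f , g ] ≈ [ h ∘ f , h ∘ g ]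
  ∘-[] {f = f} {g} {h} = sym (unique
    (trans assoc (∘-resp-≈ refl inject₁))
    (trans assoc (∘-resp-≈ refl inject₂)))

  ⊹-∘ : ∀ {A B C D E F} {f : B ⇒ C} {g : A ⇒ B} {h : E ⇒ F} {k : D ⇒ E} →
        (f ⊹ h) ∘ (g ⊹ k) ≈ (f ∘ g) ⊹ (h ∘ k)
  ⊹-∘ {f = f} {g} {h} {k} = trans ∘-[] ([]-cong
    (trans (sym assoc) (trans (∘-resp-≈ inject₁ refl) assoc))
    (trans (sym assoc) (trans (∘-resp-≈ inject₂ refl) assoc)))

  ⊹-resp : ∀ {A B C D} {f f′ : A ⇒ B} {g g′ : C ⇒ D} → f ≈ f′ → g ≈ g′ → f ⊹ g ≈ f′ ⊹ g′
  ⊹-resp p q = []-cong (∘-resp-≈ refl p) (∘-resp-≈ refl q)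

  ⊹-id : ∀ {A B} → id {A} ⊹ id {B} ≈ id
  ⊹-id = unique (trans identityˡ (sym identityʳ)) (trans identityˡ (sym identityʳ))

  -- congruence of _† follows from functoriality (with h = id)
  †-cong : (𝔸 : ElgotAlgebra) → let open ElgotAlgebra 𝔸 in
           ∀ {X} {e e′ : X ⇒ H₀ X + A} → e ≈ e′ → e † ≈ e′ †
  †-cong 𝔸 {e = e} {e′} p =
    trans (†-functorial e e′ id
            (trans (∘-resp-≈ (trans (⊹-resp identity refl) ⊹-id) refl)
                   (trans identityˡ (trans p (sym identityʳ)))))
          identityʳ
    where open ElgotAlgebra 𝔸

  •-∘ : ∀ {X Y Z W} {g : Z ⇒ W} {h : Y ⇒ Z} {e : X ⇒ H₀ X + Y} → g • (h • e) ≈ (g ∘ h) • e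
  •-∘ = trans (sym assoc) (∘-resp-≈ (trans ⊹-∘ (⊹-resp identityˡ refl)) refl)

  •-id : ∀ {X Y} {e : X ⇒ H₀ X + Y} → id • e ≈ e
  •-id = trans (∘-resp-≈ ⊹-id refl) identityˡ

  CElgot : Category (o ⊔ ℓ ⊔ e) (o ⊔ ℓ ⊔ e) e
  CElgot = record
    { Obj = ElgotAlgebra
    ; _⇒_ = ElgotHom
    ; _≈_ = λ h k → ElgotHom.mor h ≈ ElgotHom.mor k
    ; id = λ {𝔸} → record
        { mor = id
        ; preserves-† = λ e → trans identityˡ (†-cong 𝔸 (sym •-id)) }
    ; _∘_ = λ {𝔸} {𝔹} {ℂ} g h → record
        { mor = ElgotHom.mor g ∘ ElgotHom.mor h
        ; preserves-† = λ e → trans assoc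
            (trans (∘-resp-≈ refl (ElgotHom.preserves-† h e))
            (trans (ElgotHom.preserves-† g _) (†-cong ℂ •-∘))) }
    ; assoc = assoc
    ; identityˡ = identityˡ
    ; identityʳ = identityʳ
    ; equiv = record { refl = refl ; sym = sym ; trans = trans }
    ; ∘-resp-≈ = ∘-resp-≈
    }

  -- The free completely iterative monad 𝕋, given by free cias TY on every Y,
  -- presented as a Kleisli triple (η, (-)♯), and its Eilenberg–Moore category.

  module FreeCIAMonad (fc : FreeCIAs) where

    T₀ : Obj → Obj
    T₀ Y = FreeCIA.T (fc Y)

    ηT : ∀ {Y} → Y ⇒ T₀ Y
    ηT {Y} = FreeCIA.η (fc Y)

    _♯ : ∀ {Y Z} → Y ⇒ T₀ Z → T₀ Y ⇒ T₀ Z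
    _♯ {Y} {Z} f = FreeCIA.ext (fc Y) (FreeCIA.cia (fc Z)) f

    T₁ : ∀ {Y Z} → Y ⇒ Z → T₀ Y ⇒ T₀ Z
    T₁ f = (ηT ∘ f) ♯

    μT : ∀ {Y} → T₀ (T₀ Y) ⇒ T₀ Y
    μT = id ♯

    private
      αT : ∀ {Y} → H₀ (T₀ Y) ⇒ T₀ Y
      αT {Y} = FreeCIA.α (fc Y)

      ♯-hom : ∀ {Y Z} (f : Y ⇒ T₀ Z) → IsAlgHom αT αT (f ♯)
      ♯-hom {Y} {Z} f = FreeCIA.ext-hom (fc Y) (FreeCIA.cia (fc Z)) f

      ♯-η : ∀ {Y Z} (f : Y ⇒ T₀ Z) → (f ♯) ∘ ηT ≈ f
      ♯-η {Y} {Z} f = FreeCIA.ext-η (fc Y) (FreeCIA.cia (fc Z)) f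

      ♯-unique : ∀ {Y Z} (f : Y ⇒ T₀ Z) (h : T₀ Y ⇒ T₀ Z) →
                 IsAlgHom αT αT h → h ∘ ηT ≈ f → h ≈ f ♯
      ♯-unique {Y} {Z} f h = FreeCIA.ext-unique (fc Y) (FreeCIA.cia (fc Z)) f h

      hom-∘ : ∀ {A B C} {α : H₀ A ⇒ A} {β : H₀ B ⇒ B} {γ : H₀ C ⇒ C} {g : B ⇒ C} {h : A ⇒ B} →
              IsAlgHom β γ g → IsAlgHom α β h → IsAlgHom α γ (g ∘ h)
      hom-∘ {g = g} {h} p q =
        trans assoc (trans (∘-resp-≈ refl q) (trans (sym assoc)
          (trans (∘-resp-≈ p refl) (trans assoc (∘-resp-≈ refl (sym homomorphism))))))

    T-identity : ∀ {Y} → T₁ (id {Y}) ≈ id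
    T-identity = sym (♯-unique _ id (trans identityˡ (sym (trans (∘-resp-≈ refl identity) identityʳ)))
                                    (trans identityˡ (sym identityʳ)))

    T-homomorphism : ∀ {X Y Z} {f : X ⇒ Y} {g : Y ⇒ Z} → T₁ (g ∘ f) ≈ T₁ g ∘ T₁ f
    T-homomorphism {f = f} {g} = sym (♯-unique _ _ (hom-∘ (♯-hom _) (♯-hom _))
      (trans assoc (trans (∘-resp-≈ refl (♯-η _)) (trans (sym assoc)
        (trans (∘-resp-≈ (♯-η _) refl) assoc)))))

    record EMAlgebra : Set (o ⊔ ℓ ⊔ e) where
      field
        A    : Obj
        a    : T₀ A ⇒ A
        unit : a ∘ ηT ≈ id
        mult : a ∘ T₁ a ≈ a ∘ μT

    record EMHom (𝔸 𝔹 : EMAlgebra) : Set (ℓ ⊔ e) where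
      private
        module 𝔸 = EMAlgebra 𝔸
        module 𝔹 = EMAlgebra 𝔹
      field
        mor     : 𝔸.A ⇒ 𝔹.A
        commute : mor ∘ 𝔸.a ≈ 𝔹.a ∘ T₁ mor

    EM : Category (o ⊔ ℓ ⊔ e) (ℓ ⊔ e) e
    EM = record
      { Obj = EMAlgebra
      ; _⇒_ = EMHom
      ; _≈_ = λ h k → EMHom.mor h ≈ EMHom.mor k
      ; id = λ {𝔸} → record
          { mor = id
          ; commute = trans identityˡ (sym (trans (∘-resp-≈ refl T-identity) identityʳ)) }
      ; _∘_ = λ {𝔸} {𝔹} {ℂ} g h → record
          { mor = EMHom.mor g ∘ EMHom.mor h
          ; commute = trans assoc (trans (∘-resp-≈ refl (EMHom.commute h))
              (trans (sym assoc) (trans (∘-resp-≈ (EMHom.commute g) refl)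
              (trans assoc (∘-resp-≈ refl (sym T-homomorphism)))))) }
      ; assoc = assoc
      ; identityˡ = identityˡ
      ; identityʳ = identityʳ
      ; equiv = record { refl = refl ; sym = sym ; trans = trans }
      ; ∘-resp-≈ = ∘-resp-≈
      }

-- Objects of C and D are records carrying morphisms of a setoid-enriched 𝒜,
-- so "G (F X) = X" is expressed as: G(F X) has the same carrier as X and the
-- identity of that carrier is an isomorphism G(F X) ≅ X in C, natural in X
-- (i.e. the structures coincide and G ∘ F acts as the identity on morphisms).

module _ {o ℓ e : Level} (𝒜 : Category o ℓ e) where
  open Category 𝒜

  castₐ : ∀ {A B : Obj} → A ≡ B → A ⇒ B
  castₐ ≡-refl = id

  record IsoOfCategories {oc ℓc ec od ℓd ed : Level}
         (C : Category oc ℓc ec) (D : Category od ℓd ed)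
         (UC₀ : Category.Obj C → Obj)
         (UC₁ : ∀ {X Y} → Category._⇒_ C X Y → UC₀ X ⇒ UC₀ Y)
         (UD₀ : Category.Obj D → Obj)
         (UD₁ : ∀ {X Y} → Category._⇒_ D X Y → UD₀ X ⇒ UD₀ Y)
         : Set (oc ⊔ ℓc ⊔ ec ⊔ od ⊔ ℓd ⊔ ed ⊔ ℓ ⊔ e ⊔ o) where
    private
      module C = Category C
      module D = Category D
    field
      F : Functor C D
      G : Functor D C
    open Functor F using (F₀; F₁)
    open Functor G renaming (F₀ to G₀; F₁ to G₁)
    field
      GF-carrier : ∀ X → UC₀ (G₀ (F₀ X)) ≡ UC₀ X
      GF-to      : ∀ X → C._⇒_ (G₀ (F₀ X)) X
      GF-from    : ∀ X → C._⇒_ X (G₀ (F₀ X))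
      GF-to-id   : ∀ X → UC₁ (GF-to X) ≈ castₐ (GF-carrier X)
      GF-iso₁    : ∀ X → GF-to X C.∘ GF-from X C.≈ C.id
      GF-iso₂    : ∀ X → GF-from X C.∘ GF-to X C.≈ C.id
      GF-natural : ∀ {X Y} (h : C._⇒_ X Y) →
                   GF-to Y C.∘ G₁ (F₁ h) C.≈ h C.∘ GF-to X
      FG-carrier : ∀ Y → UD₀ (F₀ (G₀ Y)) ≡ UD₀ Y
      FG-to      : ∀ Y → D._⇒_ (F₀ (G₀ Y)) Y
      FG-from    : ∀ Y → D._⇒_ Y (F₀ (G₀ Y))
      FG-to-id   : ∀ Y → UD₁ (FG-to Y) ≈ castₐ (FG-carrier Y)
      FG-iso₁    : ∀ Y → FG-to Y D.∘ FG-from Y D.≈ D.id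
      FG-iso₂    : ∀ Y → FG-from Y D.∘ FG-to Y D.≈ D.id
      FG-natural : ∀ {X Y} (h : D._⇒_ X Y) →
                   FG-to Y D.∘ F₁ (G₁ h) D.≈ h D.∘ FG-to X

{-# OPTIONS --safe #-}
-- The free completely iterative algebra TY is the final coalgebra of H(-) + Y, so its structure
-- [ α , η ] : H(TY) + Y → TY is invertible, with inverse κ, and the Kleisli extension of f is the
-- solution of f • κ.  A complete Elgot algebra A becomes a 𝕋-algebra via κ† : TA → A:
-- compositionality and functoriality of † make κ† solution-preserving, which yields the unit and
-- multiplication laws.  Conversely a 𝕋-algebra a : TA → A solves e : X → HX + A by a applied to the
-- solution of η • e in TA.  The two constructions are mutually inverse and leave carriers and
-- morphisms unchanged.
module Submission where

open import Level using (Level)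
open import Relation.Binary.PropositionalEquality using () renaming (refl to ≡-refl)
import Relation.Binary.Reasoning.Setoid as SetoidReasoning
open import Defs

module _ {o ℓ e : Level} (𝒜 : Category o ℓ e) (cop : FiniteCoproducts 𝒜) (H : Functor 𝒜 𝒜) where

  open Category 𝒜
  open FiniteCoproducts cop
  open Functor H renaming (F₀ to H₀; F₁ to H₁)
  open Theory 𝒜 cop H
  open Equiv

  module HomReasoning {A B : Obj} = SetoidReasoning (hom-setoid A B)
  open HomReasoning

  infixr 4 _⟩∘⟨_ refl⟩∘⟨_
  infixl 5 _⟩∘⟨refl

  _⟩∘⟨_ : ∀ {A B C} {f h : B ⇒ C} {g i : A ⇒ B} → f ≈ h → g ≈ i → f ∘ g ≈ h ∘ i
  _⟩∘⟨_ = ∘-resp-≈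

  refl⟩∘⟨_ : ∀ {A B C} {f : B ⇒ C} {g i : A ⇒ B} → g ≈ i → f ∘ g ≈ f ∘ i
  refl⟩∘⟨ p = refl ⟩∘⟨ p

  _⟩∘⟨refl : ∀ {A B C} {f h : B ⇒ C} {g : A ⇒ B} → f ≈ h → f ∘ g ≈ h ∘ g
  p ⟩∘⟨refl = p ⟩∘⟨ refl

  pullˡ : ∀ {A B C D} {a : C ⇒ D} {b : B ⇒ C} {c : B ⇒ D} {f : A ⇒ B} →
          a ∘ b ≈ c → a ∘ (b ∘ f) ≈ c ∘ f
  pullˡ p = trans (sym assoc) (p ⟩∘⟨refl)

  pullʳ : ∀ {A B C D} {a : C ⇒ D} {b : B ⇒ C} {c : A ⇒ C} {f : A ⇒ B} →
          b ∘ f ≈ c → (a ∘ b) ∘ f ≈ a ∘ c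
  pullʳ p = trans assoc (refl⟩∘⟨ p)

  elimˡ : ∀ {A B} {f : B ⇒ B} {g : A ⇒ B} → f ≈ id → f ∘ g ≈ g
  elimˡ p = trans (p ⟩∘⟨refl) identityˡ

  elimʳ : ∀ {A B} {f : A ⇒ A} {g : A ⇒ B} → f ≈ id → g ∘ f ≈ g
  elimʳ p = trans (refl⟩∘⟨ p) identityʳ

  []∘⊹ : ∀ {A B C D E} {f : B ⇒ E} {g : D ⇒ E} {h : A ⇒ B} {k : C ⇒ D} →
         [ f , g ] ∘ (h ⊹ k) ≈ [ f ∘ h , g ∘ k ]
  []∘⊹ = trans ∘-[] ([]-cong (pullˡ inject₁) (pullˡ inject₂))

  +-ext : ∀ {A B C} {p q : A + B ⇒ C} → p ∘ inl ≈ q ∘ inl → p ∘ inr ≈ q ∘ inr → p ≈ q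
  +-ext p q = trans (sym (unique refl refl)) (unique (sym p) (sym q))

  id⊹∘⊹id : ∀ {A B C D} {f : A ⇒ B} {g : C ⇒ D} → (id ⊹ g) ∘ (f ⊹ id) ≈ (f ⊹ id) ∘ (id ⊹ g)
  id⊹∘⊹id = trans ⊹-∘ (trans (⊹-resp (trans identityˡ (sym identityʳ))
                                       (trans identityʳ (sym identityˡ)))
                              (sym ⊹-∘))

  H⊹id-∘ : ∀ {A B C D} {f : B ⇒ C} {g : A ⇒ B} → (H₁ f ⊹ id {D}) ∘ (H₁ g ⊹ id) ≈ H₁ (f ∘ g) ⊹ id
  H⊹id-∘ = trans ⊹-∘ (⊹-resp (sym homomorphism) identityˡ)

  H⊹id-identity : ∀ {A D} {f : A ⇒ A} → f ≈ id → H₁ f ⊹ id {D} ≈ id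
  H⊹id-identity p = trans (⊹-resp (trans (F-resp-≈ p) identity) refl) ⊹-id

  H⊹id-elim : ∀ {A B D} {f : A ⇒ A} {x : B ⇒ H₀ A + D} → f ≈ id → (H₁ f ⊹ id) ∘ x ≈ x
  H⊹id-elim p = elimˡ (H⊹id-identity p)

  •-resp : ∀ {X Y Z} {g g′ : Y ⇒ Z} {k : X ⇒ H₀ X + Y} → g ≈ g′ → g • k ≈ g′ • k
  •-resp p = ⊹-resp refl p ⟩∘⟨refl

  •-square : ∀ {X Y A B} {g : A ⇒ B} {k : X ⇒ H₀ X + A} {f : Y ⇒ H₀ Y + A} {h : X ⇒ Y} →
             (H₁ h ⊹ id) ∘ k ≈ f ∘ h → (H₁ h ⊹ id) ∘ (g • k) ≈ (g • f) ∘ h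
  •-square p = trans (pullˡ (sym id⊹∘⊹id)) (trans (pullʳ p) (sym assoc))

  solution-rhs : ∀ {A B X} {β : H₀ B ⇒ B} {s : X ⇒ B} {k : A ⇒ H₀ X + B} →
                 [ β , id ] ∘ (H₁ s ⊹ id) ∘ k ≈ [ β ∘ H₁ s , id ] ∘ k
  solution-rhs = pullˡ (trans []∘⊹ ([]-cong refl identityˡ))

  solution-rhs-• : ∀ {B X Y} {β : H₀ B ⇒ B} {s : X ⇒ B} {g : Y ⇒ B} {k : X ⇒ H₀ X + Y} →
                   [ β , id ] ∘ (H₁ s ⊹ id) ∘ (g • k) ≈ [ β ∘ H₁ s , g ] ∘ k
  solution-rhs-• = trans solution-rhs (pullˡ (trans []∘⊹ ([]-cong identityʳ identityˡ)))

  []⊹id∘assocʳ : ∀ {P Q R C} {p : P ⇒ C} {q : Q ⇒ C} →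
                 ([ p , q ] ⊹ id {R}) ∘ assocʳ ≈ [ inl ∘ p , [ inl ∘ q , inr ] ]
  []⊹id∘assocʳ = trans ∘-[] ([]-cong (trans (pullˡ inject₁) (pullʳ inject₁))
                                     (trans ∘-[] ([]-cong (trans (pullˡ inject₁) (pullʳ inject₂))
                                                          (trans inject₂ identityʳ))))

  id⊹∘assocʳ : ∀ {P Q R S} {g : R ⇒ S} → (id ⊹ g) ∘ assocʳ {P} {Q} ≈ assocʳ ∘ (id ⊹ (id ⊹ g))
  id⊹∘assocʳ = trans ∘-[] (trans
    ([]-cong (trans (pullˡ inject₁) (identityʳ ⟩∘⟨refl))
             (trans ∘-[] ([]-cong (trans (pullˡ inject₁) (identityʳ ⟩∘⟨refl)) inject₂)))
    (sym (trans []∘⊹ ([]-cong identityʳ (trans []∘⊹ ([]-cong identityʳ refl))))))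

  H⊹id∘⊕ : ∀ {X Y A B} (h : X + Y ⇒ B) (f : Y ⇒ H₀ Y + A) (e : X ⇒ H₀ X + Y) →
           (H₁ h ⊹ id) ∘ (f ⊕ e)
             ≈ [ [ inl ∘ H₁ (h ∘ inl) , (H₁ (h ∘ inr) ⊹ id) ∘ f ] ∘ e , (H₁ (h ∘ inr) ⊹ id) ∘ f ]
  H⊹id∘⊕ h f e = begin
    (H₁ h ⊹ id) ∘ (can ⊹ id) ∘ assocʳ ∘ (id ⊹ f) ∘ [ e , inr ]
      ≈⟨ pullˡ (trans ⊹-∘ (⊹-resp (trans ∘-[] ([]-cong (sym homomorphism) (sym homomorphism)))
                                  identityˡ)) ⟩
    ([ H₁ (h ∘ inl) , H₁ (h ∘ inr) ] ⊹ id) ∘ assocʳ ∘ (id ⊹ f) ∘ [ e , inr ]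
      ≈⟨ pullˡ []⊹id∘assocʳ ⟩
    [ inl ∘ H₁ (h ∘ inl) , [ inl ∘ H₁ (h ∘ inr) , inr ] ] ∘ (id ⊹ f) ∘ [ e , inr ]
      ≈⟨ pullˡ (trans []∘⊹ ([]-cong identityʳ ([]-cong refl (sym identityʳ) ⟩∘⟨refl))) ⟩
    [ inl ∘ H₁ (h ∘ inl) , (H₁ (h ∘ inr) ⊹ id) ∘ f ] ∘ [ e , inr ]
      ≈⟨ trans ∘-[] ([]-cong refl inject₂) ⟩
    [ [ inl ∘ H₁ (h ∘ inl) , (H₁ (h ∘ inr) ⊹ id) ∘ f ] ∘ e , (H₁ (h ∘ inr) ⊹ id) ∘ f ] ∎

  •-⊕ : ∀ {X Y A C} {g : A ⇒ C} {f : Y ⇒ H₀ Y + A} {e : X ⇒ H₀ X + Y} → g • (f ⊕ e) ≈ (g • f) ⊕ e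
  •-⊕ {g = g} {f} {e} = begin
    (id ⊹ g) ∘ (can ⊹ id) ∘ assocʳ ∘ (id ⊹ f) ∘ [ e , inr ]          ≈⟨ pullˡ id⊹∘⊹id ⟩
    ((can ⊹ id) ∘ (id ⊹ g)) ∘ assocʳ ∘ (id ⊹ f) ∘ [ e , inr ]        ≈⟨ pullʳ (pullˡ id⊹∘assocʳ) ⟩
    (can ⊹ id) ∘ (assocʳ ∘ (id ⊹ (id ⊹ g))) ∘ (id ⊹ f) ∘ [ e , inr ]
      ≈⟨ refl⟩∘⟨ pullʳ (pullˡ (trans ⊹-∘ (⊹-resp identityˡ refl))) ⟩
    (can ⊹ id) ∘ assocʳ ∘ (id ⊹ ((id ⊹ g) ∘ f)) ∘ [ e , inr ]        ∎

  module CIA {B : Obj} {β : H₀ B ⇒ B} (c : IsCIA B β) where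
    open IsCIA c

    sol-resp : ∀ {X} {k k′ : X ⇒ H₀ X + B} → k ≈ k′ → sol k ≈ sol k′
    sol-resp {k = k} {k′} p = sol-unique k′ (sol k) (trans (sol-isSol k) (refl⟩∘⟨ refl⟩∘⟨ p))

    sol-unfold : ∀ {X} {k : X ⇒ H₀ X + B} → sol k ≈ [ β ∘ H₁ (sol k) , id ] ∘ k
    sol-unfold {k = k} = trans (sol-isSol k) solution-rhs

    sol-unfold-• : ∀ {X Y} {g : Y ⇒ B} {k : X ⇒ H₀ X + Y} →
                   sol (g • k) ≈ [ β ∘ H₁ (sol (g • k)) , g ] ∘ k
    sol-unfold-• {g = g} {k} = trans (sol-isSol (g • k)) solution-rhs-•

    sol-functorial : ∀ {X Y} (k : X ⇒ H₀ X + B) (f : Y ⇒ H₀ Y + B) (h : X ⇒ Y) →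
                     (H₁ h ⊹ id) ∘ k ≈ f ∘ h → sol k ≈ sol f ∘ h
    sol-functorial k f h p = sym (sol-unique k (sol f ∘ h) (begin
      sol f ∘ h                                           ≈⟨ sol-isSol f ⟩∘⟨refl ⟩
      ([ β , id ] ∘ (H₁ (sol f) ⊹ id) ∘ f) ∘ h            ≈⟨ pullʳ (pullʳ (sym p)) ⟩
      [ β , id ] ∘ (H₁ (sol f) ⊹ id) ∘ (H₁ h ⊹ id) ∘ k    ≈⟨ refl⟩∘⟨ pullˡ H⊹id-∘ ⟩
      [ β , id ] ∘ (H₁ (sol f ∘ h) ⊹ id) ∘ k              ∎))

    sol-compositional : ∀ {X Y} (e : X ⇒ H₀ X + Y) (f : Y ⇒ H₀ Y + B) →
                        sol (sol f • e) ≈ sol (f ⊕ e) ∘ inl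
    sol-compositional {X} {Y} e f = sym (sol-unique (sol f • e) (S ∘ inl) (begin
      S ∘ inl                                                   ≈⟨ S-unfold ⟩∘⟨refl ⟩
      ([ β , id ] ∘ [ Q ∘ e , (H₁ (S ∘ inr) ⊹ id) ∘ f ]) ∘ inl  ≈⟨ pullʳ inject₁ ⟩
      [ β , id ] ∘ Q ∘ e                                        ≈⟨ pullˡ ∘-[] ⟩
      [ [ β , id ] ∘ inl ∘ H₁ (S ∘ inl) , [ β , id ] ∘ (H₁ (S ∘ inr) ⊹ id) ∘ f ] ∘ e
        ≈⟨ []-cong (pullˡ inject₁) (trans (sym S∘inr-solves-f) S∘inr≈sol-f) ⟩∘⟨refl ⟩
      [ β ∘ H₁ (S ∘ inl) , sol f ] ∘ e                          ≈⟨ solution-rhs-• ⟨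
      [ β , id ] ∘ (H₁ (S ∘ inl) ⊹ id) ∘ (sol f • e)            ∎))
      where
      S : X + Y ⇒ B
      S = sol (f ⊕ e)
      Q : H₀ X + Y ⇒ H₀ B + B
      Q = [ inl ∘ H₁ (S ∘ inl) , (H₁ (S ∘ inr) ⊹ id) ∘ f ]
      S-unfold : S ≈ [ β , id ] ∘ [ Q ∘ e , (H₁ (S ∘ inr) ⊹ id) ∘ f ]
      S-unfold = trans (sol-isSol (f ⊕ e)) (refl⟩∘⟨ H⊹id∘⊕ S f e)
      S∘inr-solves-f : S ∘ inr ≈ [ β , id ] ∘ (H₁ (S ∘ inr) ⊹ id) ∘ f
      S∘inr-solves-f = trans (S-unfold ⟩∘⟨refl) (pullʳ inject₂)
      S∘inr≈sol-f : S ∘ inr ≈ sol f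
      S∘inr≈sol-f = sol-unique f (S ∘ inr) S∘inr-solves-f

  algHom-preserves-sol : ∀ {B C} {β : H₀ B ⇒ B} {γ : H₀ C ⇒ C} (cB : IsCIA B β) (cC : IsCIA C γ)
                         {h : B ⇒ C} → IsAlgHom β γ h →
                         ∀ {X} (k : X ⇒ H₀ X + B) → h ∘ IsCIA.sol cB k ≈ IsCIA.sol cC (h • k)
  algHom-preserves-sol {B} {β = β} {γ} cB cC {h} h-hom {X} k =
    IsCIA.sol-unique cC (h • k) (h ∘ s) (begin
      h ∘ s                                     ≈⟨ refl⟩∘⟨ CIA.sol-unfold cB ⟩
      h ∘ [ β ∘ H₁ s , id ] ∘ k                 ≈⟨ pullˡ ∘-[] ⟩
      [ h ∘ β ∘ H₁ s , h ∘ id ] ∘ k             ≈⟨ []-cong h∘β∘H₁s identityʳ ⟩∘⟨refl ⟩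
      [ γ ∘ H₁ (h ∘ s) , h ] ∘ k                ≈⟨ solution-rhs-• ⟨
      [ γ , id ] ∘ (H₁ (h ∘ s) ⊹ id) ∘ (h • k)  ∎)
    where
    s : X ⇒ B
    s = IsCIA.sol cB k
    h∘β∘H₁s : h ∘ β ∘ H₁ s ≈ γ ∘ H₁ (h ∘ s)
    h∘β∘H₁s = trans (pullˡ h-hom) (pullʳ (sym homomorphism))

  module FinalCoalgebraIsCIA {Y : Obj} (final : FinalCoalgebra Y) where
    open FinalCoalgebra final

    IsCoalgHom : ∀ {X} → X ⇒ H₀ X + Y → X ⇒ ν → Set e
    IsCoalgHom c h = τ ∘ h ≈ (H₁ h ⊹ id) ∘ c

    coalgHom-unique : ∀ {X} (c : X ⇒ H₀ X + Y) {h k : X ⇒ ν} →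
                      IsCoalgHom c h → IsCoalgHom c k → h ≈ k
    coalgHom-unique c {h} {k} p q = trans (unfold-unique c h p) (sym (unfold-unique c k q))

    id-isCoalgHom : IsCoalgHom τ id
    id-isCoalgHom = trans identityʳ (sym (H⊹id-elim refl))

    τ⁻¹ : H₀ ν + Y ⇒ ν
    τ⁻¹ = unfold (H₁ τ ⊹ id)

    τ⁻¹∘τ≈id : τ⁻¹ ∘ τ ≈ id
    τ⁻¹∘τ≈id = coalgHom-unique τ τ⁻¹∘τ-isCoalgHom id-isCoalgHom
      where
      τ⁻¹∘τ-isCoalgHom : IsCoalgHom τ (τ⁻¹ ∘ τ)
      τ⁻¹∘τ-isCoalgHom = trans (pullˡ (unfold-hom _)) (H⊹id-∘ ⟩∘⟨refl)

    τ∘τ⁻¹≈id : τ ∘ τ⁻¹ ≈ id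
    τ∘τ⁻¹≈id = trans (unfold-hom _) (trans H⊹id-∘ (H⊹id-identity τ⁻¹∘τ≈id))

    τ-mono : ∀ {X} {f g : X ⇒ ν} → τ ∘ f ≈ τ ∘ g → f ≈ g
    τ-mono {f = f} {g} p = begin
      f              ≈⟨ elimˡ τ⁻¹∘τ≈id ⟨
      (τ⁻¹ ∘ τ) ∘ f  ≈⟨ pullʳ p ⟩
      τ⁻¹ ∘ τ ∘ g    ≈⟨ trans (sym assoc) (elimˡ τ⁻¹∘τ≈id) ⟩
      g              ∎

    αν : H₀ ν ⇒ ν
    αν = τ⁻¹ ∘ inl

    ην : Y ⇒ ν
    ην = τ⁻¹ ∘ inr

    τ∘αν≈inl : τ ∘ αν ≈ inl
    τ∘αν≈inl = trans (sym assoc) (elimˡ τ∘τ⁻¹≈id)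

    τ∘ην≈inr : τ ∘ ην ≈ inr
    τ∘ην≈inr = trans (sym assoc) (elimˡ τ∘τ⁻¹≈id)

    -- Solutions s of k correspond to coalgebra homomorphisms [ s , id ] out of coalg, which runs
    -- k on X and τ on ν; so the unique solution is unfold coalg ∘ inl.
    module Solution {X : Obj} (k : X ⇒ H₀ X + ν) where
      step : ν ⇒ H₀ (X + ν) + Y
      step = (H₁ inr ⊹ id) ∘ τ

      coalg : X + ν ⇒ H₀ (X + ν) + Y
      coalg = [ [ inl ∘ H₁ inl , step ] ∘ k , step ]

      H⊹id∘step : ∀ {Z} (h : X + ν ⇒ Z) → (H₁ h ⊹ id) ∘ step ≈ (H₁ (h ∘ inr) ⊹ id) ∘ τ
      H⊹id∘step h = pullˡ H⊹id-∘

      coalg-inl : (s : X ⇒ ν) → ((H₁ [ s , id ] ⊹ id) ∘ coalg) ∘ inl ≈ [ inl ∘ H₁ s , τ ] ∘ k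
      coalg-inl s = begin
        ((H₁ [ s , id ] ⊹ id) ∘ coalg) ∘ inl                   ≈⟨ pullʳ inject₁ ⟩
        (H₁ [ s , id ] ⊹ id) ∘ [ inl ∘ H₁ inl , step ] ∘ k     ≈⟨ pullˡ ∘-[] ⟩
        [ (H₁ [ s , id ] ⊹ id) ∘ inl ∘ H₁ inl , (H₁ [ s , id ] ⊹ id) ∘ step ] ∘ k
          ≈⟨ []-cong (trans (pullˡ inject₁) (pullʳ (trans (sym homomorphism) (F-resp-≈ inject₁))))
                     (trans (H⊹id∘step [ s , id ]) (H⊹id-elim inject₂)) ⟩∘⟨refl ⟩
        [ inl ∘ H₁ s , τ ] ∘ k                                 ∎

      coalg-inr : (s : X ⇒ ν) → ((H₁ [ s , id ] ⊹ id) ∘ coalg) ∘ inr ≈ τ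
      coalg-inr s = trans (pullʳ inject₂) (trans (H⊹id∘step [ s , id ]) (H⊹id-elim inject₂))

      τ∘solution-rhs : (s : X ⇒ ν) → τ ∘ [ αν , id ] ∘ (H₁ s ⊹ id) ∘ k ≈ [ inl ∘ H₁ s , τ ] ∘ k
      τ∘solution-rhs s = begin
        τ ∘ [ αν , id ] ∘ (H₁ s ⊹ id) ∘ k  ≈⟨ refl⟩∘⟨ solution-rhs ⟩
        τ ∘ [ αν ∘ H₁ s , id ] ∘ k         ≈⟨ pullˡ ∘-[] ⟩
        [ τ ∘ αν ∘ H₁ s , τ ∘ id ] ∘ k     ≈⟨ []-cong (pullˡ τ∘αν≈inl) identityʳ ⟩∘⟨refl ⟩
        [ inl ∘ H₁ s , τ ] ∘ k             ∎

      solution⇒coalgHom : (s : X ⇒ ν) → IsSolution αν k s → IsCoalgHom coalg [ s , id ]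
      solution⇒coalgHom s p = +-ext
        (begin
          (τ ∘ [ s , id ]) ∘ inl                ≈⟨ pullʳ inject₁ ⟩
          τ ∘ s                                 ≈⟨ refl⟩∘⟨ p ⟩
          τ ∘ [ αν , id ] ∘ (H₁ s ⊹ id) ∘ k     ≈⟨ τ∘solution-rhs s ⟩
          [ inl ∘ H₁ s , τ ] ∘ k                ≈⟨ coalg-inl s ⟨
          ((H₁ [ s , id ] ⊹ id) ∘ coalg) ∘ inl  ∎)
        (trans (pullʳ inject₂) (trans identityʳ (sym (coalg-inr s))))

      coalgHom⇒solution : (s : X ⇒ ν) → IsCoalgHom coalg [ s , id ] → IsSolution αν k s
      coalgHom⇒solution s p = τ-mono (begin
        τ ∘ s                                 ≈⟨ pullʳ inject₁ ⟨
        (τ ∘ [ s , id ]) ∘ inl                ≈⟨ p ⟩∘⟨refl ⟩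
        ((H₁ [ s , id ] ⊹ id) ∘ coalg) ∘ inl  ≈⟨ coalg-inl s ⟩
        [ inl ∘ H₁ s , τ ] ∘ k                ≈⟨ τ∘solution-rhs s ⟨
        τ ∘ [ αν , id ] ∘ (H₁ s ⊹ id) ∘ k     ∎)

      unfold∘inr≈id : unfold coalg ∘ inr ≈ id
      unfold∘inr≈id = coalgHom-unique τ (begin
        τ ∘ unfold coalg ∘ inr                         ≈⟨ pullˡ (unfold-hom coalg) ⟩
        ((H₁ (unfold coalg) ⊹ id) ∘ coalg) ∘ inr       ≈⟨ pullʳ inject₂ ⟩
        (H₁ (unfold coalg) ⊹ id) ∘ step                ≈⟨ H⊹id∘step (unfold coalg) ⟩
        (H₁ (unfold coalg ∘ inr) ⊹ id) ∘ τ             ∎) id-isCoalgHom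

      solution : X ⇒ ν
      solution = unfold coalg ∘ inl

      unfold≈[solution,id] : unfold coalg ≈ [ solution , id ]
      unfold≈[solution,id] = +-ext (sym inject₁) (trans unfold∘inr≈id (sym inject₂))

      solution-isSol : IsSolution αν k solution
      solution-isSol = coalgHom⇒solution solution (begin
        τ ∘ [ solution , id ]                   ≈⟨ refl⟩∘⟨ unfold≈[solution,id] ⟨
        τ ∘ unfold coalg                        ≈⟨ unfold-hom coalg ⟩
        (H₁ (unfold coalg) ⊹ id) ∘ coalg
          ≈⟨ ⊹-resp (F-resp-≈ unfold≈[solution,id]) refl ⟩∘⟨refl ⟩
        (H₁ [ solution , id ] ⊹ id) ∘ coalg     ∎)

      solution-unique : (s : X ⇒ ν) → IsSolution αν k s → s ≈ solution
      solution-unique s p = begin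
        s                   ≈⟨ inject₁ ⟨
        [ s , id ] ∘ inl    ≈⟨ unfold-unique coalg [ s , id ] (solution⇒coalgHom s p) ⟩∘⟨refl ⟩
        unfold coalg ∘ inl  ∎

    abstract
      ν-isCIA : IsCIA ν αν
      ν-isCIA = record
        { sol        = Solution.solution
        ; sol-isSol  = Solution.solution-isSol
        ; sol-unique = Solution.solution-unique
        }

  module FreeCIAInverse {Y : Obj} (free : FreeCIA Y) (final : FinalCoalgebra Y) where
    open FreeCIA free
    open FinalCoalgebra final using (ν; τ)
    open FinalCoalgebraIsCIA final

    toν : T ⇒ ν
    toν = ext ν-isCIA ην

    fromν : ν ⇒ T
    fromν = IsCIA.sol cia (η • τ)

    fromν∘τ⁻¹ : fromν ∘ τ⁻¹ ≈ [ α ∘ H₁ fromν , η ]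
    fromν∘τ⁻¹ = trans (CIA.sol-unfold-• cia ⟩∘⟨refl) (trans (pullʳ τ∘τ⁻¹≈id) identityʳ)

    fromν∘toν≈id : fromν ∘ toν ≈ id
    fromν∘toν≈id = trans (ext-unique cia η (fromν ∘ toν) fromν∘toν-isAlgHom fromν∘toν∘η≈η)
                         (sym (ext-unique cia η id id-isAlgHom identityˡ))
      where
      fromν∘toν-isAlgHom : IsAlgHom α α (fromν ∘ toν)
      fromν∘toν-isAlgHom = begin
        (fromν ∘ toν) ∘ α          ≈⟨ pullʳ (ext-hom ν-isCIA ην) ⟩
        fromν ∘ αν ∘ H₁ toν        ≈⟨ pullˡ (trans (pullˡ fromν∘τ⁻¹) inject₁) ⟩
        (α ∘ H₁ fromν) ∘ H₁ toν    ≈⟨ pullʳ (sym homomorphism) ⟩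
        α ∘ H₁ (fromν ∘ toν)       ∎
      fromν∘toν∘η≈η : (fromν ∘ toν) ∘ η ≈ η
      fromν∘toν∘η≈η =
        trans (pullʳ (ext-η ν-isCIA ην)) (trans (pullˡ fromν∘τ⁻¹) inject₂)
      id-isAlgHom : IsAlgHom α α id
      id-isAlgHom = trans identityˡ (sym (elimʳ identity))

    κ : T ⇒ H₀ T + Y
    κ = (H₁ fromν ⊹ id) ∘ τ ∘ toν

    κ∘α≈inl : κ ∘ α ≈ inl
    κ∘α≈inl = begin
      ((H₁ fromν ⊹ id) ∘ τ ∘ toν) ∘ α      ≈⟨ pullʳ (pullʳ (ext-hom ν-isCIA ην)) ⟩
      (H₁ fromν ⊹ id) ∘ τ ∘ αν ∘ H₁ toν    ≈⟨ refl⟩∘⟨ pullˡ τ∘αν≈inl ⟩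
      (H₁ fromν ⊹ id) ∘ inl ∘ H₁ toν       ≈⟨ pullˡ inject₁ ⟩
      (inl ∘ H₁ fromν) ∘ H₁ toν            ≈⟨ pullʳ (sym homomorphism) ⟩
      inl ∘ H₁ (fromν ∘ toν)               ≈⟨ elimʳ (trans (F-resp-≈ fromν∘toν≈id) identity) ⟩
      inl                                  ∎

    κ∘η≈inr : κ ∘ η ≈ inr
    κ∘η≈inr = begin
      ((H₁ fromν ⊹ id) ∘ τ ∘ toν) ∘ η  ≈⟨ pullʳ (pullʳ (ext-η ν-isCIA ην)) ⟩
      (H₁ fromν ⊹ id) ∘ τ ∘ ην         ≈⟨ refl⟩∘⟨ τ∘ην≈inr ⟩
      (H₁ fromν ⊹ id) ∘ inr            ≈⟨ trans inject₂ identityʳ ⟩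
      inr                              ∎

    [α,η]∘κ≈id : [ α , η ] ∘ κ ≈ id
    [α,η]∘κ≈id = begin
      [ α , η ] ∘ (H₁ fromν ⊹ id) ∘ τ ∘ toν  ≈⟨ pullˡ (trans []∘⊹ ([]-cong refl identityʳ)) ⟩
      [ α ∘ H₁ fromν , η ] ∘ τ ∘ toν         ≈⟨ pullˡ (sym (CIA.sol-unfold-• cia)) ⟩
      fromν ∘ toν                            ≈⟨ fromν∘toν≈id ⟩
      id                                     ∎

    sol-η•κ≈id : IsCIA.sol cia (η • κ) ≈ id
    sol-η•κ≈id = sym (IsCIA.sol-unique cia (η • κ) id (sym (begin
      [ α , id ] ∘ (H₁ id ⊹ id) ∘ (η • κ)  ≈⟨ solution-rhs-• ⟩
      [ α ∘ H₁ id , η ] ∘ κ                ≈⟨ []-cong (elimʳ identity) refl ⟩∘⟨refl ⟩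
      [ α , η ] ∘ κ                        ≈⟨ [α,η]∘κ≈id ⟩
      id                                   ∎)))

    κ∘sol : ∀ {X} (g : X ⇒ H₀ X + T) → κ ∘ IsCIA.sol cia g ≈ [ inl ∘ H₁ (IsCIA.sol cia g) , κ ] ∘ g
    κ∘sol g = begin
      κ ∘ sol g                            ≈⟨ refl⟩∘⟨ CIA.sol-unfold cia ⟩
      κ ∘ [ α ∘ H₁ (sol g) , id ] ∘ g      ≈⟨ pullˡ ∘-[] ⟩
      [ κ ∘ α ∘ H₁ (sol g) , κ ∘ id ] ∘ g  ≈⟨ []-cong (pullˡ κ∘α≈inl) identityʳ ⟩∘⟨refl ⟩
      [ inl ∘ H₁ (sol g) , κ ] ∘ g         ∎
      where open IsCIA cia using (sol)

    ext≈sol-•κ : ∀ {B} {β : H₀ B ⇒ B} (c : IsCIA B β) (f : Y ⇒ B) → ext c f ≈ IsCIA.sol c (f • κ)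
    ext≈sol-•κ {β = β} c f = sym (ext-unique c f (sol (f • κ)) sol-isAlgHom sol∘η≈f)
      where
      open IsCIA c using (sol)
      sol-isAlgHom : IsAlgHom α β (sol (f • κ))
      sol-isAlgHom = trans (CIA.sol-unfold-• c ⟩∘⟨refl) (trans (pullʳ κ∘α≈inl) inject₁)
      sol∘η≈f : sol (f • κ) ∘ η ≈ f
      sol∘η≈f = trans (CIA.sol-unfold-• c ⟩∘⟨refl) (trans (pullʳ κ∘η≈inr) inject₂)

  module Elgot≅EM (it : Iteratable) (fc : FreeCIAs) where
    open FreeCIAMonad fc

    αT : ∀ {Y} → H₀ (T₀ Y) ⇒ T₀ Y
    αT {Y} = FreeCIA.α (fc Y)

    ciaT : ∀ Y → IsCIA (T₀ Y) αT
    ciaT Y = FreeCIA.cia (fc Y)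

    solT : ∀ {Y X} → X ⇒ H₀ X + T₀ Y → X ⇒ T₀ Y
    solT {Y} = IsCIA.sol (ciaT Y)

    solT-resp : ∀ {Y X} {k k′ : X ⇒ H₀ X + T₀ Y} → k ≈ k′ → solT k ≈ solT k′
    solT-resp {Y} = CIA.sol-resp (ciaT Y)

    module Inverse {Y : Obj} = FreeCIAInverse (fc Y) (it Y)
    open Inverse using (κ∘η≈inr; κ∘sol; sol-η•κ≈id) renaming (κ to κT)

    ♯-isAlgHom : ∀ {Y Z} (f : Y ⇒ T₀ Z) → IsAlgHom αT αT (f ♯)
    ♯-isAlgHom {Y} {Z} f = FreeCIA.ext-hom (fc Y) (ciaT Z) f

    ♯∘η : ∀ {Y Z} (f : Y ⇒ T₀ Z) → f ♯ ∘ ηT ≈ f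
    ♯∘η {Y} {Z} f = FreeCIA.ext-η (fc Y) (ciaT Z) f

    ♯≈solT : ∀ {Y Z} (f : Y ⇒ T₀ Z) → f ♯ ≈ solT (f • κT)
    ♯≈solT {Z = Z} f = Inverse.ext≈sol-•κ (ciaT Z) f

    μ≈solT-κ : ∀ {Y} → μT {Y} ≈ solT κT
    μ≈solT-κ = trans (♯≈solT id) (solT-resp •-id)

    module ElgotToEM (𝔸 : ElgotAlgebra) where
      open ElgotAlgebra 𝔸

      a : T₀ A ⇒ A
      a = κT †

      abstract
        -- Compositionality makes (a • g)† the left component of the solution of κT ⊕ g, and
        -- functoriality along [ solT g , id ] identifies that solution with a ∘ [ solT g , id ].
        a-preserves-sol : ∀ {X} (g : X ⇒ H₀ X + T₀ A) → a ∘ solT g ≈ (a • g) †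
        a-preserves-sol {X} g = sym (begin
          (a • g) †               ≈⟨ †-compositional g κT ⟩
          (κT ⊕ g) † ∘ inl        ≈⟨ †-functorial (κT ⊕ g) κT h H⊹id∘κT⊕g≈κT∘h ⟩∘⟨refl ⟩
          (a ∘ h) ∘ inl           ≈⟨ pullʳ inject₁ ⟩
          a ∘ solT g              ∎)
          where
          h : X + T₀ A ⇒ T₀ A
          h = [ solT g , id ]
          H⊹id∘κT⊕g≈κT∘h : (H₁ h ⊹ id) ∘ (κT ⊕ g) ≈ κT ∘ h
          H⊹id∘κT⊕g≈κT∘h = begin
            (H₁ h ⊹ id) ∘ (κT ⊕ g)
              ≈⟨ H⊹id∘⊕ h κT g ⟩
            [ [ inl ∘ H₁ (h ∘ inl) , (H₁ (h ∘ inr) ⊹ id) ∘ κT ] ∘ g , (H₁ (h ∘ inr) ⊹ id) ∘ κT ]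
              ≈⟨ []-cong ([]-cong (refl⟩∘⟨ F-resp-≈ inject₁) (H⊹id-elim inject₂) ⟩∘⟨refl)
                         (H⊹id-elim inject₂) ⟩
            [ [ inl ∘ H₁ (solT g) , κT ] ∘ g , κT ]
              ≈⟨ []-cong (κ∘sol g) identityʳ ⟨
            [ κT ∘ solT g , κT ∘ id ]
              ≈⟨ ∘-[] ⟨
            κT ∘ h ∎

        a-unfold : a ≈ [ α ∘ H₁ a , id ] ∘ κT
        a-unfold = trans (†-solution κT) solution-rhs

        a∘η≈id : a ∘ ηT ≈ id
        a∘η≈id = trans (a-unfold ⟩∘⟨refl) (trans (pullʳ κ∘η≈inr) inject₂)

        a∘η∘f≈f : ∀ {Z} (f : Z ⇒ A) → a ∘ ηT ∘ f ≈ f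
        a∘η∘f≈f f = trans (sym assoc) (elimˡ a∘η≈id)

        a∘T₁a≈a∘μ : a ∘ T₁ a ≈ a ∘ μT
        a∘T₁a≈a∘μ = begin
          a ∘ T₁ a                       ≈⟨ refl⟩∘⟨ ♯≈solT (ηT ∘ a) ⟩
          a ∘ solT ((ηT ∘ a) • κT)       ≈⟨ a-preserves-sol _ ⟩
          (a • ((ηT ∘ a) • κT)) †        ≈⟨ †-cong 𝔸 (trans •-∘ (•-resp (a∘η∘f≈f a))) ⟩
          (a • κT) †                     ≈⟨ a-preserves-sol κT ⟨
          a ∘ solT κT                    ≈⟨ refl⟩∘⟨ μ≈solT-κ ⟨
          a ∘ μT                         ∎

      algebra : EMAlgebra
      algebra = record { A = A ; a = a ; unit = a∘η≈id ; mult = a∘T₁a≈a∘μ }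

    elgotHom⇒emHom : ∀ {𝔸 𝔹} → ElgotHom 𝔸 𝔹 → EMHom (ElgotToEM.algebra 𝔸) (ElgotToEM.algebra 𝔹)
    elgotHom⇒emHom {𝔸} {𝔹} h = record { mor = mor ; commute = commute }
      where
      open ElgotHom h
      open ElgotAlgebra 𝔹 using (_†)
      module 𝔸 = ElgotToEM 𝔸
      module 𝔹 = ElgotToEM 𝔹
      commute : mor ∘ 𝔸.a ≈ 𝔹.a ∘ T₁ mor
      commute = begin
        mor ∘ 𝔸.a                         ≈⟨ preserves-† κT ⟩
        (mor • κT) †                      ≈⟨ †-cong 𝔹 (trans •-∘ (•-resp (𝔹.a∘η∘f≈f mor))) ⟨
        (𝔹.a • ((ηT ∘ mor) • κT)) †       ≈⟨ 𝔹.a-preserves-sol _ ⟨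
        𝔹.a ∘ solT ((ηT ∘ mor) • κT)      ≈⟨ refl⟩∘⟨ ♯≈solT (ηT ∘ mor) ⟨
        𝔹.a ∘ T₁ mor                      ∎

    module EMToElgot (𝔹 : EMAlgebra) where
      open EMAlgebra 𝔹

      α : H₀ A ⇒ A
      α = a ∘ αT ∘ H₁ ηT

      _‡ : ∀ {X} → X ⇒ H₀ X + A → X ⇒ A
      k ‡ = a ∘ solT (ηT • k)

      abstract
        a-isAlgHom : IsAlgHom αT α a
        a-isAlgHom = sym (begin
          (a ∘ αT ∘ H₁ ηT) ∘ H₁ a        ≈⟨ trans assoc (refl⟩∘⟨ pullʳ (sym homomorphism)) ⟩
          a ∘ αT ∘ H₁ (ηT ∘ a)           ≈⟨ refl⟩∘⟨ refl⟩∘⟨ F-resp-≈ (♯∘η (ηT ∘ a)) ⟨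
          a ∘ αT ∘ H₁ (T₁ a ∘ ηT)        ≈⟨ refl⟩∘⟨ refl⟩∘⟨ homomorphism ⟩
          a ∘ αT ∘ H₁ (T₁ a) ∘ H₁ ηT     ≈⟨ refl⟩∘⟨ pullˡ (sym (♯-isAlgHom (ηT ∘ a))) ⟩
          a ∘ (T₁ a ∘ αT) ∘ H₁ ηT        ≈⟨ trans (refl⟩∘⟨ assoc) (pullˡ mult) ⟩
          (a ∘ μT) ∘ αT ∘ H₁ ηT          ≈⟨ pullʳ (pullˡ (♯-isAlgHom id)) ⟩
          a ∘ (αT ∘ H₁ μT) ∘ H₁ ηT       ≈⟨ refl⟩∘⟨ pullʳ (sym homomorphism) ⟩
          a ∘ αT ∘ H₁ (μT ∘ ηT)          ≈⟨ refl⟩∘⟨ elimʳ (trans (F-resp-≈ (♯∘η id)) identity) ⟩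
          a ∘ αT                         ∎)

        a∘sol-absorbs-ηT∘a : ∀ {X} (k : X ⇒ H₀ X + T₀ A) → a ∘ solT k ≈ a ∘ solT ((ηT ∘ a) • k)
        a∘sol-absorbs-ηT∘a k = sym (begin
          a ∘ solT ((ηT ∘ a) • k)
            ≈⟨ refl⟩∘⟨ solT-resp (trans (•-resp (sym (♯∘η (ηT ∘ a)))) (sym •-∘)) ⟩
          a ∘ solT (T₁ a • (ηT • k))
            ≈⟨ refl⟩∘⟨ algHom-preserves-sol (ciaT _) (ciaT A) (♯-isAlgHom (ηT ∘ a)) (ηT • k) ⟨
          a ∘ T₁ a ∘ solT (ηT • k)
            ≈⟨ pullˡ mult ⟩
          (a ∘ μT) ∘ solT (ηT • k)
            ≈⟨ pullʳ (algHom-preserves-sol (ciaT _) (ciaT A) (♯-isAlgHom id) (ηT • k)) ⟩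
          a ∘ solT (μT • (ηT • k))
            ≈⟨ refl⟩∘⟨ solT-resp (trans •-∘ (trans (•-resp (♯∘η id)) •-id)) ⟩
          a ∘ solT k ∎)

        ‡-solution : ∀ {X} (k : X ⇒ H₀ X + A) → IsSolution α k (k ‡)
        ‡-solution {X} k = begin
          a ∘ s                                ≈⟨ refl⟩∘⟨ CIA.sol-unfold-• (ciaT A) ⟩
          a ∘ [ αT ∘ H₁ s , ηT ] ∘ k           ≈⟨ pullˡ ∘-[] ⟩
          [ a ∘ αT ∘ H₁ s , a ∘ ηT ] ∘ k       ≈⟨ []-cong a∘αT∘H₁s unit ⟩∘⟨refl ⟩
          [ α ∘ H₁ (a ∘ s) , id ] ∘ k          ≈⟨ solution-rhs ⟨
          [ α , id ] ∘ (H₁ (a ∘ s) ⊹ id) ∘ k   ∎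
          where
          s : X ⇒ T₀ A
          s = solT (ηT • k)
          a∘αT∘H₁s : a ∘ αT ∘ H₁ s ≈ α ∘ H₁ (a ∘ s)
          a∘αT∘H₁s = trans (pullˡ a-isAlgHom) (pullʳ (sym homomorphism))

        ‡-functorial : ∀ {X Y} (k : X ⇒ H₀ X + A) (f : Y ⇒ H₀ Y + A) (h : X ⇒ Y) →
                       (H₁ h ⊹ id) ∘ k ≈ f ∘ h → k ‡ ≈ f ‡ ∘ h
        ‡-functorial k f h p =
          trans (refl⟩∘⟨ CIA.sol-functorial (ciaT A) (ηT • k) (ηT • f) h (•-square p)) (sym assoc)

        ‡-compositional : ∀ {X Y} (k : X ⇒ H₀ X + Y) (f : Y ⇒ H₀ Y + A) →
                          ((f ‡) • k) ‡ ≈ ((f ⊕ k) ‡) ∘ inl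
        ‡-compositional k f = begin
          a ∘ solT (ηT • ((a ∘ solT (ηT • f)) • k))
            ≈⟨ refl⟩∘⟨ solT-resp (trans •-∘ (sym (trans •-∘ (•-resp assoc)))) ⟩
          a ∘ solT ((ηT ∘ a) • (solT (ηT • f) • k))  ≈⟨ a∘sol-absorbs-ηT∘a _ ⟨
          a ∘ solT (solT (ηT • f) • k)
            ≈⟨ refl⟩∘⟨ CIA.sol-compositional (ciaT A) k (ηT • f) ⟩
          a ∘ solT ((ηT • f) ⊕ k) ∘ inl              ≈⟨ refl⟩∘⟨ (solT-resp (sym •-⊕) ⟩∘⟨refl) ⟩
          a ∘ solT (ηT • (f ⊕ k)) ∘ inl              ≈⟨ assoc ⟨
          (a ∘ solT (ηT • (f ⊕ k))) ∘ inl            ∎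

      algebra : ElgotAlgebra
      algebra = record
        { A               = A
        ; α               = α
        ; _†              = _‡
        ; †-solution      = ‡-solution
        ; †-functorial    = ‡-functorial
        ; †-compositional = ‡-compositional
        }

    emHom⇒elgotHom : ∀ {𝔸 𝔹} → EMHom 𝔸 𝔹 → ElgotHom (EMToElgot.algebra 𝔸) (EMToElgot.algebra 𝔹)
    emHom⇒elgotHom {𝔸} {𝔹} h = record { mor = mor ; preserves-† = preserves-‡ }
      where
      open EMHom h
      module 𝔸 = EMAlgebra 𝔸
      module 𝔹 = EMAlgebra 𝔹
      preserves-‡ : ∀ {X} (k : X ⇒ H₀ X + 𝔸.A) →
                    mor ∘ 𝔸.a ∘ solT (ηT • k) ≈ 𝔹.a ∘ solT (ηT • (mor • k))
      preserves-‡ k = begin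
        mor ∘ 𝔸.a ∘ solT (ηT • k)      ≈⟨ pullˡ commute ⟩
        (𝔹.a ∘ T₁ mor) ∘ solT (ηT • k)
          ≈⟨ pullʳ (algHom-preserves-sol (ciaT 𝔸.A) (ciaT 𝔹.A) (♯-isAlgHom (ηT ∘ mor)) (ηT • k)) ⟩
        𝔹.a ∘ solT (T₁ mor • (ηT • k))
          ≈⟨ refl⟩∘⟨ solT-resp (trans •-∘ (trans (•-resp (♯∘η (ηT ∘ mor))) (sym •-∘))) ⟩
        𝔹.a ∘ solT (ηT • (mor • k))    ∎

    F : Functor CElgot EM
    F = record
      { F₀ = ElgotToEM.algebra ; F₁ = elgotHom⇒emHom
      ; identity = refl ; homomorphism = refl ; F-resp-≈ = λ p → p }

    G : Functor EM CElgot
    G = record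
      { F₀ = EMToElgot.algebra ; F₁ = emHom⇒elgotHom
      ; identity = refl ; homomorphism = refl ; F-resp-≈ = λ p → p }

    GF-†≈† : ∀ 𝔸 {X} (k : X ⇒ H₀ X + ElgotAlgebra.A 𝔸) →
             ElgotAlgebra._† (Functor.F₀ G (Functor.F₀ F 𝔸)) k ≈ ElgotAlgebra._† 𝔸 k
    GF-†≈† 𝔸 k = trans (ElgotToEM.a-preserves-sol 𝔸 (ηT • k))
                       (†-cong 𝔸 (trans •-∘ (trans (•-resp (ElgotToEM.a∘η≈id 𝔸)) •-id)))

    FG-a≈a : ∀ 𝔹 → EMAlgebra.a (Functor.F₀ F (Functor.F₀ G 𝔹)) ≈ EMAlgebra.a 𝔹
    FG-a≈a 𝔹 = elimʳ sol-η•κ≈id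

    GF-to : ∀ 𝔸 → ElgotHom (Functor.F₀ G (Functor.F₀ F 𝔸)) 𝔸
    GF-to 𝔸 = record
      { mor = id
      ; preserves-† = λ k → trans identityˡ (trans (GF-†≈† 𝔸 k) (†-cong 𝔸 (sym •-id))) }

    GF-from : ∀ 𝔸 → ElgotHom 𝔸 (Functor.F₀ G (Functor.F₀ F 𝔸))
    GF-from 𝔸 = record
      { mor = id
      ; preserves-† = λ k → trans identityˡ (sym (trans (GF-†≈† 𝔸 (id • k)) (†-cong 𝔸 •-id))) }

    FG-to : ∀ 𝔹 → EMHom (Functor.F₀ F (Functor.F₀ G 𝔹)) 𝔹
    FG-to 𝔹 = record
      { mor = id
      ; commute = trans identityˡ (trans (FG-a≈a 𝔹) (sym (elimʳ T-identity))) }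

    FG-from : ∀ 𝔹 → EMHom 𝔹 (Functor.F₀ F (Functor.F₀ G 𝔹))
    FG-from 𝔹 = record
      { mor = id
      ; commute = trans identityˡ (sym (trans (elimʳ T-identity) (FG-a≈a 𝔹))) }

theorem5p8 : ∀ {o ℓ e : Level} (𝒜 : Category o ℓ e) (cop : FiniteCoproducts 𝒜)
               (H : Functor 𝒜 𝒜) →
               Theory.Iteratable 𝒜 cop H →
               (fc : Theory.FreeCIAs 𝒜 cop H) →
               IsoOfCategories 𝒜
                 (Theory.CElgot 𝒜 cop H)
                 (Theory.FreeCIAMonad.EM 𝒜 cop H fc)
                 Theory.ElgotAlgebra.A
                 Theory.ElgotHom.mor
                 Theory.FreeCIAMonad.EMAlgebra.A
                 Theory.FreeCIAMonad.EMHom.mor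
theorem5p8 𝒜 cop H it fc = record
  { F = F ; G = G
  ; GF-carrier = λ _ → ≡-refl ; GF-to-id = λ _ → refl
  ; GF-to = GF-to ; GF-from = GF-from
  ; GF-iso₁ = λ _ → identityˡ ; GF-iso₂ = λ _ → identityˡ
  ; GF-natural = λ _ → trans identityˡ (sym identityʳ)
  ; FG-carrier = λ _ → ≡-refl ; FG-to-id = λ _ → refl
  ; FG-to = FG-to ; FG-from = FG-from
  ; FG-iso₁ = λ _ → identityˡ ; FG-iso₂ = λ _ → identityˡ
  ; FG-natural = λ _ → trans identityˡ (sym identityʳ)
  }
  where
  open Category 𝒜 using (identityˡ; identityʳ)
  open Category.Equiv 𝒜 using (refl; sym; trans)
  open Elgot≅EM 𝒜 cop H it fc
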